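{- Let $G=(V,W,E)$ be an odd bipartite graph. Then $R^{I}(G)$ is rigid for every $I \subseteq W$.
   Context: A bipartite graph $G=(V,W,E)$ (bipartition classes $V$, $W$) is odd if for every nonempty $X\subseteq W$ there is $v\in V$ with $|N(v)\cap X|$ odd. Multipede construction $R(G)$: for each $w\in W$ there are two vertices $a(w),b(w)$, and $F(w)=\{a(w),b(w)\}$; for each $v\in V$ and each $A\subseteq N(v)$ with $|A|$ even there is a vertex $m_A(v)$, and $M(v)$ is the set of these. Edges: $\{a(w),m_A(v)\}$ for $w\in A$ and $\{b(w),m_A(v)\}$ for $w\in N(v)\setminus A$; no other edges. $R(G)$ is vertex-colored so that the color classes are exactly the sets $F(w)$ ($w\in W$) and $M(v)$ ($v\in V$). For $I\subseteq W$, $R^I(G)$ is the same graph with the coloring refined so that $\{a(w)\}$ and $\{b(w)\}$ are color classes for every $w\in I$. A colored graph is rigid if its only color-preserving automorphism is the identity. -}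

module Defs where

open import Data.Nat using (ℕ; _%_)
open import Data.Unit using (⊤)
open import Data.Bool using (Bool; true; false; _∧_; not; if_then_else_)
open import Data.Fin using (Fin)
open import Data.Fin.Subset using (Subset; _⊆_; _∩_; ∣_∣; Nonempty; _∈_)
open import Data.Vec using (tabulate; lookup)
open import Data.Product using (Σ; ∃; _×_; proj₁)
open import Relation.Binary.PropositionalEquality using (_≡_)

-- A finite bipartite graph G = (V, W, E) with V = Fin n, W = Fin m,
-- given by its adjacency relation E v w (v ∈ V, w ∈ W).

N : ∀ {n m} → (Fin n → Fin m → Bool) → Fin n → Subset m
N E v = tabulate (E v)

Odd : ∀ {n m} → (Fin n → Fin m → Bool) → Set
Odd {n} {m} E = ∀ (X : Subset m) → Nonempty X → ∃ λ (v : Fin n) → ∣ N E v ∩ X ∣ % 2 ≡ 1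

-- raw vertices of R(G): a(w), b(w), m_A(v)
data RVtx (n m : ℕ) : Set where
  a  : Fin m → RVtx n m
  b  : Fin m → RVtx n m
  mv : Fin n → Subset m → RVtx n m

Valid : ∀ {n m} → (Fin n → Fin m → Bool) → RVtx n m → Set
Valid E (a w) = ⊤
Valid E (b w) = ⊤
Valid E (mv v A) = (A ⊆ N E v) × (∣ A ∣ % 2 ≡ 0)

Vertex : ∀ {n m} → (Fin n → Fin m → Bool) → Set
Vertex {n} {m} E = Σ (RVtx n m) (Valid E)

adj : ∀ {n m} → (Fin n → Fin m → Bool) → RVtx n m → RVtx n m → Bool
adj E (a w) (mv v A) = lookup A w
adj E (b w) (mv v A) = E v w ∧ not (lookup A w)
adj E (mv v A) (a w) = lookup A w
adj E (mv v A) (b w) = E v w ∧ not (lookup A w)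
adj E _ _ = false

data Colour (n m : ℕ) : Set where
  cF : Fin m → Colour n m
  cA : Fin m → Colour n m
  cB : Fin m → Colour n m
  cM : Fin n → Colour n m

colourI : ∀ {n m} → Subset m → RVtx n m → Colour n m
colourI I (a w) = if lookup I w then cA w else cF w
colourI I (b w) = if lookup I w then cB w else cF w
colourI I (mv v A) = cM v

record Automorphism {n m} (E : Fin n → Fin m → Bool) (I : Subset m) : Set where
  field
    f       : Vertex E → Vertex E
    g       : Vertex E → Vertex E
    g∘f     : ∀ x → proj₁ (g (f x)) ≡ proj₁ x
    f∘g     : ∀ y → proj₁ (f (g y)) ≡ proj₁ y
    edges   : ∀ x y → adj E (proj₁ (f x)) (proj₁ (f y)) ≡ adj E (proj₁ x) (proj₁ y)
    colours : ∀ x → colourI I (proj₁ (f x)) ≡ colourI I (proj₁ x)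

Rigid : ∀ {n m} → (Fin n → Fin m → Bool) → Subset m → Set
Rigid E I = ∀ (φ : Automorphism E I) (x : Vertex E) → proj₁ (Automorphism.f φ x) ≡ proj₁ x

module Submission where

-- Let φ be a colour-preserving automorphism of R^I(G).  Since φ keeps each
-- colour class F(w) = {a(w), b(w)}, it either fixes or swaps a(w); write
-- X ⊆ W for the set of w where it swaps.  The vertex m_∅(v) is adjacent to
-- no a(w), so its image m_B(v) is adjacent to no φ(a(w)); checking w by w,
-- this forces B = N(v) ∩ X ("silent-set").  As |B| is even, X meets every
-- neighbourhood evenly, and oddness of G makes X empty
-- ("evenly-met⇒empty").  Hence φ fixes every a(w); it then fixes every b(w)
-- by injectivity, and every m_A(v) because A is recovered from the
-- neighbours a(w) of m_A(v).

open import Defs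
open import Data.Nat using (ℕ; _%_)
open import Data.Bool using (Bool; true; false; _∧_; not)
open import Data.Fin using (Fin)
open import Data.Fin.Subset using (Subset; _⊆_; _∩_; ∣_∣; ⊥)
open import Data.Fin.Subset.Properties using (∣⊥∣≡0; ⊥⊆)
open import Data.Bool.Properties using (not-injective)
open import Data.Vec using (Vec; lookup; tabulate)
open import Data.Vec.Properties
  using (lookup-zipWith; lookup-replicate; lookup∘tabulate; tabulate∘lookup; tabulate-cong; []=⇒lookup; lookup⇒[]=)
open import Data.Product using (∃; _,_; proj₁; proj₂)
open import Data.Unit using (tt)
open import Data.Empty using (⊥-elim)
open import Relation.Nullary using (¬_)
open import Relation.Binary.PropositionalEquality

vec-ext : ∀ {A : Set} {k} (xs ys : Vec A k) → (∀ i → lookup xs i ≡ lookup ys i) → xs ≡ ys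
vec-ext xs ys same = begin
  xs                   ≡⟨ sym (tabulate∘lookup xs) ⟩
  tabulate (lookup xs) ≡⟨ tabulate-cong same ⟩
  tabulate (lookup ys) ≡⟨ tabulate∘lookup ys ⟩
  ys                   ∎
  where open ≡-Reasoning

true≢false : ¬ (true ≡ false)
true≢false ()

module _ {n m : ℕ} where

  pick : Bool → Fin m → RVtx n m
  pick false w = a w
  pick true  w = b w

  block : RVtx n m → Colour n m
  block (a w)    = cF w
  block (b w)    = cF w
  block (mv v _) = cM v

  coarsen : Colour n m → Colour n m
  coarsen (cA w) = cF w
  coarsen (cB w) = cF w
  coarsen c      = c

  coarsen-colour : ∀ (I : Subset m) r → coarsen (colourI I r) ≡ block r
  coarsen-colour I (a w) with lookup I w
  ... | true  = refl
  ... | false = refl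
  coarsen-colour I (b w) with lookup I w
  ... | true  = refl
  ... | false = refl
  coarsen-colour I (mv v A) = refl

  same-block : ∀ (I : Subset m) r s → colourI I r ≡ colourI I s → block r ≡ block s
  same-block I r s eq = begin
    block r                ≡⟨ sym (coarsen-colour I r) ⟩
    coarsen (colourI I r)  ≡⟨ cong coarsen eq ⟩
    coarsen (colourI I s)  ≡⟨ coarsen-colour I s ⟩
    block s                ∎
    where open ≡-Reasoning

  in-F : ∀ w r → block r ≡ cF w → ∃ λ x → r ≡ pick x w
  in-F w (a .w) refl = false , refl
  in-F w (b .w) refl = true , refl

  in-M : ∀ v r → block r ≡ cM v → ∃ λ B → r ≡ mv v B
  in-M v (mv .v B) refl = B , refl

module _ {n m : ℕ} (E : Fin n → Fin m → Bool) where

  empty-vertex : Fin n → Vertex E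
  empty-vertex v = mv v ⊥ , (λ x∈⊥ → ⊥⊆ x∈⊥) , cong (_% 2) (∣⊥∣≡0 m)

  silent-entry : ∀ x w v B → adj E (pick x w) (mv v B) ≡ false → E v w ≡ true → lookup B w ≡ x
  silent-entry false w v B nonadj _ = nonadj
  silent-entry true  w v B nonadj ev =
    not-injective (subst (λ e → e ∧ not (lookup B w) ≡ false) ev nonadj)

  outside-entry : ∀ w v B → B ⊆ N E v → E v w ≡ false → lookup B w ≡ false
  outside-entry w v B B⊆N ev with lookup B w in eB
  ... | false = refl
  ... | true  = ⊥-elim (true≢false in-N)
    where
    in-N : true ≡ false
    in-N = begin
      true              ≡⟨ sym ([]=⇒lookup (B⊆N (lookup⇒[]= w B eB))) ⟩
      lookup (N E v) w  ≡⟨ lookup∘tabulate (E v) w ⟩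
      E v w             ≡⟨ ev ⟩
      false             ∎
      where open ≡-Reasoning

  silent-set : ∀ (X : Subset m) v B → B ⊆ N E v →
               (∀ w → adj E (pick (lookup X w) w) (mv v B) ≡ false) → B ≡ N E v ∩ X
  silent-set X v B B⊆N nonadj = vec-ext B (N E v ∩ X) entry
    where
    entry-∧ : ∀ w → lookup B w ≡ E v w ∧ lookup X w
    entry-∧ w with E v w in ev
    ... | true  = silent-entry (lookup X w) w v B (nonadj w) ev
    ... | false = outside-entry w v B B⊆N ev

    entry : ∀ w → lookup B w ≡ lookup (N E v ∩ X) w
    entry w = trans (entry-∧ w) (sym (trans (lookup-zipWith _∧_ w (N E v) X)
                                      (cong (_∧ lookup X w) (lookup∘tabulate (E v) w))))

  evenly-met⇒empty : Odd E → ∀ (X : Subset m) → (∀ v → ∣ N E v ∩ X ∣ % 2 ≡ 0) → ∀ w → lookup X w ≡ false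
  evenly-met⇒empty odd X even w with lookup X w in eX
  ... | false = refl
  ... | true  with v , isOdd ← odd X (w , lookup⇒[]= w X eX)
              with () ← trans (sym (even v)) isOdd

  vertex-a : ∀ w (s : Vertex E) → proj₁ s ≡ a w → s ≡ (a w , tt)
  vertex-a w (.(a w) , tt) refl = refl

module _ {n m : ℕ} (E : Fin n → Fin m → Bool) (I : Subset m) (φ : Automorphism E I) where
  open Automorphism φ

  stays-in-block : ∀ x → block (proj₁ (f x)) ≡ block (proj₁ x)
  stays-in-block x = same-block I (proj₁ (f x)) (proj₁ x) (colours x)

  flip-of : ∀ w → ∃ λ x → proj₁ (f (a w , tt)) ≡ pick x w
  flip-of w = in-F w _ (stays-in-block (a w , tt))

  flipped : Subset m
  flipped = tabulate (λ w → proj₁ (flip-of w))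

  image-a : ∀ w → proj₁ (f (a w , tt)) ≡ pick (lookup flipped w) w
  image-a w = trans (proj₂ (flip-of w)) (cong (λ x → pick x w) (sym (lookup∘tabulate _ w)))

  -- φ(m_∅(v)) = m_{N(v) ∩ flipped}(v), so flipped meets N(v) evenly.
  flipped-evenly-met : ∀ v → ∣ N E v ∩ flipped ∣ % 2 ≡ 0
  flipped-evenly-met v with B , image ← in-M v _ (stays-in-block (empty-vertex E v))
    with B⊆N , evenB ← subst (Valid E) image (proj₂ (f (empty-vertex E v)))
    = subst (λ C → ∣ C ∣ % 2 ≡ 0) (silent-set E flipped v B B⊆N nonadj) evenB
    where
    nonadj : ∀ w → adj E (pick (lookup flipped w) w) (mv v B) ≡ false
    nonadj w = begin
      adj E (pick (lookup flipped w) w) (mv v B)                      ≡⟨ sym (cong₂ (adj E) (image-a w) image) ⟩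
      adj E (proj₁ (f (a w , tt))) (proj₁ (f (empty-vertex E v)))     ≡⟨ edges (a w , tt) (empty-vertex E v) ⟩
      lookup ⊥ w                                                      ≡⟨ lookup-replicate w false ⟩
      false                                                           ∎
      where open ≡-Reasoning

  fixes-a : Odd E → ∀ w → proj₁ (f (a w , tt)) ≡ a w
  fixes-a odd w = trans (image-a w)
    (cong (λ x → pick x w) (evenly-met⇒empty E odd flipped flipped-evenly-met w))

  -- If φ fixes a(w) it fixes b(w): φ(b(w)) = a(w) = φ(a(w)) contradicts injectivity.
  fixes-b : ∀ w → proj₁ (f (a w , tt)) ≡ a w → proj₁ (f (b w , tt)) ≡ b w
  fixes-b w fa with in-F w _ (stays-in-block (b w , tt))
  ... | true  , fb = fb
  ... | false , fb = ⊥-elim (b≢a collision)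
    where
    b≢a : ¬ (b {n} w ≡ a w)
    b≢a ()

    collision : b w ≡ a w
    collision = begin
      b w                        ≡⟨ sym (g∘f (b w , tt)) ⟩
      proj₁ (g (f (b w , tt)))   ≡⟨ cong (λ s → proj₁ (g s)) (vertex-a E w _ fb) ⟩
      proj₁ (g (a w , tt))       ≡⟨ cong (λ s → proj₁ (g s)) (sym (vertex-a E w _ fa)) ⟩
      proj₁ (g (f (a w , tt)))   ≡⟨ g∘f (a w , tt) ⟩
      a w                        ∎
      where open ≡-Reasoning

  -- If φ fixes every a(w) it fixes every m_A(v): A is the set of w with
  -- a(w) adjacent to m_A(v).
  fixes-m : (∀ w → proj₁ (f (a w , tt)) ≡ a w) → ∀ v A (valid : Valid E (mv v A)) →
            proj₁ (f (mv v A , valid)) ≡ mv v A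
  fixes-m fa v A valid with B , image ← in-M v _ (stays-in-block (mv v A , valid))
    = trans image (cong (mv v) (vec-ext B A same-entries))
    where
    same-entries : ∀ w → lookup B w ≡ lookup A w
    same-entries w = trans (sym (cong₂ (adj E) (fa w) image)) (edges (a w , tt) (mv v A , valid))

lemma3 : ∀ {n m : ℕ} (E : Fin n → Fin m → Bool) → Odd E → ∀ (I : Subset m) → Rigid E I
lemma3 E odd I φ (a w , tt)      = fixes-a E I φ odd w
lemma3 E odd I φ (b w , tt)      = fixes-b E I φ w (fixes-a E I φ odd w)
lemma3 E odd I φ (mv v A , valid) = fixes-m E I φ (fixes-a E I φ odd) v A valid
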